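{- Let $k\ge1$ and $n\ge1$. There is a bijection between the set of descending $k$-Naples parking functions of length $n$ that are not descending $(k-1)$-Naples parking functions and the set of Dyck paths of length $n+k$ whose first $k$ steps are Up, whose last $k+1$ steps are Down, and which return to the line $y=0$ at some point before the last step.
   Context: A Dyck path of length $m$ is a lattice path from $(0,0)$ to $(2m,0)$ with $m$ Up steps $(1,1)$ and $m$ Down steps $(1,-1)$ never going below $y=0$. Parking rules: $n$ spots $1,\dots,n$; cars $c_1,\dots,c_n$ arrive in order with preferences $a_j\in[n]$; $k$-Naples rule: $c_j$ parks at $a_j$ if empty, otherwise checks spots $a_j-1,\dots,a_j-k$ (those $\ge1$) in order and parks in the first empty one, otherwise drives forward from $a_j$ and parks in the first empty spot after $a_j$ (failing if none). A preference is a $k$-Naples parking function if all cars park; $0$-Naples parking functions are ordinary parking functions. Descending means weakly decreasing. -}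

module Defs where

open import Data.Bool using (Bool; true; false; _∧_; _∨_; not; if_then_else_)
open import Data.Nat using (ℕ; zero; suc; _+_; _∸_; _≤ᵇ_; _<ᵇ_; _≡ᵇ_)
open import Data.List using (List; []; _∷_; _++_; map; applyUpTo; take; reverse)
open import Data.Bool.ListAction using (any; all)
open import Data.Maybe using (Maybe; just; nothing; is-just)
open import Data.Fin using (Fin; toℕ)
open import Data.Vec using (Vec; toList)

-- Parking spots are numbered 1..n.  The state of the lot is the list of
-- occupied spot numbers.

occupied : List ℕ → ℕ → Bool
occupied occ s = any (λ t → t ≡ᵇ s) occ

firstEmpty : List ℕ → List ℕ → Maybe ℕ
firstEmpty occ [] = nothing
firstEmpty occ (s ∷ ss) = if occupied occ s then firstEmpty occ ss else just s

backCands : ℕ → ℕ → List ℕ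
backCands k a = map (λ i → a ∸ i) (filterLt (applyUpTo suc k))
  where
  filterLt : List ℕ → List ℕ
  filterLt [] = []
  filterLt (i ∷ is) = if i <ᵇ a then i ∷ filterLt is else filterLt is

fwdCands : ℕ → ℕ → List ℕ
fwdCands n a = applyUpTo (λ i → a + suc i) (n ∸ a)

parkOne : ℕ → ℕ → List ℕ → ℕ → Maybe ℕ
parkOne k n occ a =
  if occupied occ a then firstEmpty occ (backCands k a ++ fwdCands n a) else just a

parkAll : ℕ → ℕ → List ℕ → List ℕ → Maybe (List ℕ)
parkAll k n occ [] = just occ
parkAll k n occ (a ∷ as) with parkOne k n occ a
... | nothing = nothing
... | just s  = parkAll k n (s ∷ occ) as

-- preference list (a_1,...,a_n) with a_j ∈ [n]; Fin n value i stands for spot i+1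
prefs : {n : ℕ} → Vec (Fin n) n → List ℕ
prefs a = map (λ i → suc (toℕ i)) (toList a)

isNaplesPF : (k : ℕ) {n : ℕ} → Vec (Fin n) n → Bool
isNaplesPF k {n} a = is-just (parkAll k n [] (prefs a))

descendingL : List ℕ → Bool
descendingL [] = true
descendingL (x ∷ []) = true
descendingL (x ∷ y ∷ xs) = (y ≤ᵇ x) ∧ descendingL (y ∷ xs)

isDescending : {n : ℕ} → Vec (Fin n) n → Bool
isDescending a = descendingL (prefs a)

-- Lattice paths as step lists: true = Up (1,1), false = Down (1,-1).

dyckFrom : ℕ → List Bool → Bool
dyckFrom h [] = h ≡ᵇ 0
dyckFrom h (true ∷ s) = dyckFrom (suc h) s
dyckFrom zero (false ∷ s) = false
dyckFrom (suc h) (false ∷ s) = dyckFrom h s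

isDyck : List Bool → Bool
isDyck = dyckFrom 0

stepH : ℕ → Bool → ℕ
stepH h true = suc h
stepH h false = h ∸ 1

returnsBeforeLastFrom : ℕ → List Bool → Bool
returnsBeforeLastFrom h (x ∷ y ∷ s) =
  (stepH h x ≡ᵇ 0) ∨ returnsBeforeLastFrom (stepH h x) (y ∷ s)
returnsBeforeLastFrom h _ = false

-- Dyck path (of length m, the length being fixed by the Vec index 2m)
-- whose first k steps are Up, last k+1 steps are Down, and which returns
-- to y = 0 before the last step.
isTargetPath : ℕ → List Bool → Bool
isTargetPath k s =
  isDyck s
  ∧ all (λ b → b) (take k s)
  ∧ all not (take (suc k) (reverse s))
  ∧ returnsBeforeLastFrom 0 s

-- A weakly decreasing preference list a₁ ≥ ⋯ ≥ aₙ with entries in [1, n] is a k-Naples parking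
-- function iff aᵢ + (i − 1) ≤ n + k for every i (`Capped`): the first i cars all park at spots
-- ≥ aᵢ − k, of which there are at most n + k + 1 − aᵢ; conversely a car that fails finds every
-- spot it can reach taken, while under the bound the top i spots are reachable and only i − 1
-- cars have parked. So being k- but not (k − 1)-Naples means meeting the bound with equality
-- somewhere (`Touches`). Started at height k + 1, the staircase U^(n−a₁) D U^(a₁−a₂) D ⋯ D U^(aₙ−1)
-- is at height n + k − (i − 1) − aᵢ after its i-th D, so the bound says it stays weakly above 0
-- and equality says it reaches 0. Traversed backwards and framed by k Ups and k + 1 Downs, these
-- staircases are exactly the target Dyck paths.

module Submission where

open import Defs
open import Data.Nat
  using (ℕ; zero; suc; pred; _+_; _*_; _∸_; _≤_; _<_; z≤n; s≤s; s≤s⁻¹; z<s; _<ᵇ_; _≡ᵇ_; _≤?_; _<?_)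
open import Data.Nat.Properties
open import Data.Nat.Tactic.RingSolver using (solve-∀)
open import Data.Bool using (Bool; true; false; T; not; _∧_; if_then_else_)
open import Data.Bool.Properties using (T-∧; T-∨; T-≡; T-not-≡; T-irrelevant; not-involutive)
open import Data.Bool.ListAction using (all)
open import Data.Fin using (Fin; toℕ; fromℕ<)
open import Data.Fin.Properties using (toℕ-fromℕ<; toℕ-injective; toℕ<n)
open import Data.List using (List; []; _∷_; _++_; [_]; map; filter; applyUpTo; take; drop; reverse; replicate; length)
open import Data.List.Properties
  using (++-assoc; ++-identityʳ; reverse-++; reverse-involutive; unfold-reverse; length-++; length-replicate;
         length-reverse; length-drop; length-applyUpTo; length-removeAt′; map-injective)
open import Data.List.Membership.Propositional using (_∈_; _∉_)
open import Data.List.Membership.Propositional.Properties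
  using (∈-map⁺; ∈-map⁻; ∈-++⁺ˡ; ∈-++⁺ʳ; ∈-++⁻; ∈-filter⁺; ∈-filter⁻; ∈-applyUpTo⁺; ∈-applyUpTo⁻)
open import Data.List.Relation.Binary.Subset.Propositional using (_⊆_)
open import Data.List.Relation.Unary.Any using (here; there; _─_)
import Data.List.Relation.Unary.Any as Any
open import Data.List.Relation.Unary.Any.Properties using (any⁺; any⁻)
open import Data.List.Relation.Unary.All using (All; []; _∷_)
import Data.List.Relation.Unary.All as All
open import Data.List.Relation.Unary.All.Properties using (¬Any⇒All¬)
open import Data.List.Relation.Unary.Unique.Propositional using (Unique; []; _∷_)
open import Data.List.Relation.Unary.Unique.Propositional.Properties using (applyUpTo⁺₁)
open import Data.Maybe using (just; nothing; is-just)
open import Data.Vec using (Vec; []; _∷_; toList; fromList; cast)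
open import Data.Vec.Properties using (toList-injective; toList-cast; toList∘fromList; length-toList; cast-is-id)
open import Data.Product using (Σ; ∃; ∃₂; _×_; _,_; proj₁; proj₂)
open import Data.Product.Properties using (Σ-≡,≡→≡)
open import Data.Sum using (_⊎_; inj₁; inj₂)
import Data.Sum as Sum
open import Data.Empty using (⊥; ⊥-elim)
open import Data.Unit using (⊤; tt)
open import Function.Bundles using (_⤖_; mk↔ₛ′; Equivalence)
open import Function.Properties.Inverse using (↔⇒⤖)
open import Relation.Nullary using (¬_; contradiction; yes; no)
open import Relation.Binary.PropositionalEquality
  using (_≡_; _≢_; refl; sym; trans; cong; cong₂; subst; module ≡-Reasoning)
open import Relation.Binary.Definitions using (tri<; tri≈; tri>)

open Equivalence using (to; from)

private variable
  a b h h′ k l m n v w x y : ℕ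
  occ as : List ℕ
  c : Bool
  s t S X P : List Bool

-- The k-Naples rule for a single car

IsSpot : ℕ → ℕ → Set
IsSpot n y = 1 ≤ y × y ≤ n

CanPark : ℕ → ℕ → ℕ → ℕ → Set
CanPark k n a y = IsSpot n y × a ≤ y + k

-- `backCands` filters with a function local to its definition, which cannot be named here; any
-- function with its defining equations is `filter (_<? a)`, and in `backCands≡map-filter` the local
-- one is obtained by unification once its list argument is abstracted.
filter-unique : ∀ a (G : List ℕ → List ℕ) → G [] ≡ [] →
  (∀ i is → G (i ∷ is) ≡ (if i <ᵇ a then i ∷ G is else G is)) →
  ∀ is → G is ≡ filter (_<? a) is
filter-unique a G G[] G∷ [] = G[]
filter-unique a G G[] G∷ (i ∷ is) rewrite G∷ i is with i <ᵇ a
... | true  = cong (i ∷_) (filter-unique a G G[] G∷ is)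
... | false = filter-unique a G G[] G∷ is

backCands≡map-filter : ∀ k a → backCands k a ≡ map (a ∸_) (filter (_<? a) (applyUpTo suc k))
backCands≡map-filter k a = trans unfolded (cong (map (a ∸_)) (filter-unique a G refl (λ _ _ → refl) (applyUpTo suc k)))
  where
  G : List ℕ → List ℕ
  G = _
  unfolded : backCands k a ≡ map (a ∸_) (G (applyUpTo suc k))
  unfolded with applyUpTo suc k
  ... | _ = refl

∈-backCands⁻ : y ∈ backCands k a → 1 ≤ y × y < a × a ≤ y + k
∈-backCands⁻ {y} {k} {a} y∈
  with i , i∈ , refl ← ∈-map⁻ (a ∸_) (subst (y ∈_) (backCands≡map-filter k a) y∈)
  with i∈′ , i<a ← ∈-filter⁻ (_<? a) {xs = applyUpTo suc k} i∈
  with j , j<k , refl ← ∈-applyUpTo⁻ suc i∈′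
  = m<n⇒0<n∸m i<a
  , ∸-monoʳ-< z<s (<⇒≤ i<a)
  , ≤-trans (≤-reflexive (sym (m∸n+n≡m (<⇒≤ i<a)))) (+-monoʳ-≤ (a ∸ suc j) j<k)

∈-backCands⁺ : 1 ≤ y → y < a → a ≤ y + k → y ∈ backCands k a
∈-backCands⁺ {y} {a} {k} 1≤y y<a a≤y+k rewrite backCands≡map-filter k a =
  subst (_∈ _) (m∸[m∸n]≡n (<⇒≤ y<a))
    (∈-map⁺ (a ∸_) (∈-filter⁺ (_<? a) (∈-applyUpTo-suc (m<n⇒0<n∸m y<a) (m≤n+o⇒m∸n≤o a y a≤y+k))
                                      (∸-monoʳ-< 1≤y (<⇒≤ y<a))))
  where
  ∈-applyUpTo-suc : ∀ {i} → 1 ≤ i → i ≤ k → i ∈ applyUpTo suc k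
  ∈-applyUpTo-suc {suc j} _ j<k = ∈-applyUpTo⁺ suc j<k

∈-fwdCands⁻ : y ∈ fwdCands n a → a < y × y ≤ n
∈-fwdCands⁻ {n = n} {a} y∈ with j , j<n∸a , refl ← ∈-applyUpTo⁻ (λ i → a + suc i) y∈ =
  m<m+n a z<s , ≤-trans (+-monoʳ-≤ a j<n∸a) (≤-reflexive (m+[n∸m]≡n a≤n))
  where
  a≤n : a ≤ n
  a≤n = <⇒≤ (m∸n≢0⇒n<m (m<n⇒n≢0 j<n∸a))

∈-fwdCands⁺ : a < y → y ≤ n → y ∈ fwdCands n a
∈-fwdCands⁺ {a} {y} {n} a<y y≤n =
  subst (_∈ _) (trans (+-suc a (y ∸ suc a)) (m+[n∸m]≡n a<y))
    (∈-applyUpTo⁺ (λ i → a + suc i) (≤-trans (≤-reflexive (sym (+-∸-assoc 1 a<y))) (∸-monoˡ-≤ a y≤n)))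

occupied≡true⇒∈ : occupied occ y ≡ true → y ∈ occ
occupied≡true⇒∈ {occ} {y} eq =
  Any.map (λ t≡ᵇy → sym (≡ᵇ⇒≡ _ y t≡ᵇy)) (any⁻ (_≡ᵇ y) occ (subst T (sym eq) tt))

occupied≡false⇒∉ : occupied occ y ≡ false → y ∉ occ
occupied≡false⇒∉ {y = y} eq y∈ =
  subst T eq (any⁺ (_≡ᵇ y) (Any.map (λ { refl → ≡⇒≡ᵇ y y refl }) y∈))

firstEmpty-just : ∀ cands → firstEmpty occ cands ≡ just y → y ∈ cands × y ∉ occ
firstEmpty-just {occ} (c ∷ cands) eq with occupied occ c in occ-c
... | true with y∈ , y∉ ← firstEmpty-just cands eq = there y∈ , y∉
firstEmpty-just {occ} (c ∷ cands) refl | false = here refl , occupied≡false⇒∉ occ-c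

firstEmpty-nothing : ∀ cands → firstEmpty occ cands ≡ nothing → y ∈ cands → y ∈ occ
firstEmpty-nothing {occ} (c ∷ cands) eq y∈ with occupied occ c in occ-c | y∈
... | true  | here refl = occupied≡true⇒∈ occ-c
... | true  | there y∈′ = firstEmpty-nothing cands eq y∈′
firstEmpty-nothing {occ} (c ∷ cands) () y∈ | false | _

parkOne-just : IsSpot n a → parkOne k n occ a ≡ just y → y ∉ occ × CanPark k n a y
parkOne-just {n} {a} {k} {occ} (1≤a , a≤n) eq with occupied occ a in occ-a
parkOne-just {n} {a} {k} {occ} (1≤a , a≤n) refl | false = occupied≡false⇒∉ occ-a , (1≤a , a≤n) , m≤m+n a k
... | true with y∈ , y∉ ← firstEmpty-just (backCands k a ++ fwdCands n a) eq with ∈-++⁻ (backCands k a) y∈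
... | inj₁ back with 1≤y , y<a , a≤y+k ← ∈-backCands⁻ back =
  y∉ , (1≤y , ≤-trans (<⇒≤ y<a) a≤n) , a≤y+k
... | inj₂ fwd with a<y , y≤n ← ∈-fwdCands⁻ fwd =
  y∉ , (≤-trans 1≤a (<⇒≤ a<y) , y≤n) , ≤-trans (<⇒≤ a<y) (m≤m+n _ k)

parkOne-nothing : parkOne k n occ a ≡ nothing → CanPark k n a y → y ∈ occ
parkOne-nothing {k} {n} {occ} {a} {y} eq ((1≤y , y≤n) , a≤y+k) with occupied occ a in occ-a
... | false with () ← eq
... | true with <-cmp y a
...   | tri< y<a _ _ = firstEmpty-nothing _ eq (∈-++⁺ˡ (∈-backCands⁺ 1≤y y<a a≤y+k))
...   | tri≈ _ refl _ = occupied≡true⇒∈ occ-a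
...   | tri> _ _ a<y = firstEmpty-nothing _ eq (∈-++⁺ʳ (backCands k a) (∈-fwdCands⁺ a<y y≤n))

-- Counting parked cars

∈-─ : ∀ {A : Set} {z y : A} ys (y∈ : y ∈ ys) → z ∈ ys → z ≢ y → z ∈ (ys ─ y∈)
∈-─ (_ ∷ _)  (here refl) (here refl) z≢y = contradiction refl z≢y
∈-─ (_ ∷ _)  (here refl) (there z∈)  _   = z∈
∈-─ (_ ∷ _)  (there y∈)  (here refl) _   = here refl
∈-─ (_ ∷ ys) (there y∈)  (there z∈)  z≢y = there (∈-─ ys y∈ z∈ z≢y)

Unique⇒length≤ : ∀ {A : Set} {xs ys : List A} → Unique xs → xs ⊆ ys → length xs ≤ length ys
Unique⇒length≤ [] _ = z≤n
Unique⇒length≤ {xs = y ∷ xs} {ys} (y≢xs ∷ uxs) xs⊆ys =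
  ≤-trans (s≤s (Unique⇒length≤ uxs xs⊆ys─y)) (≤-reflexive (sym (length-removeAt′ ys _)))
  where
  y∈ys = xs⊆ys (here refl)
  xs⊆ys─y : xs ⊆ (ys ─ y∈ys)
  xs⊆ys─y z∈ = ∈-─ ys y∈ys (xs⊆ys (there z∈)) (λ z≡y → All.lookup y≢xs z∈ (sym z≡y))

topSpots : ℕ → ℕ → List ℕ
topSpots n c = applyUpTo (n ∸_) c

topSpots-unique : ∀ {n c} → c ≤ n → Unique (topSpots n c)
topSpots-unique {n} {c} c≤n = applyUpTo⁺₁ (n ∸_) c λ i<j j<c n∸i≡n∸j →
  <⇒≢ i<j (∸-cancelˡ-≡ (<⇒≤ (<-trans i<j (<-≤-trans j<c c≤n))) (<⇒≤ (<-≤-trans j<c c≤n)) n∸i≡n∸j)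

-- Descending parking functions

-- The i-th entry is bounded by b − (i − 1); entries are positive throughout, so `pred` never truncates.
Capped : ℕ → List ℕ → Set
Capped b [] = ⊤
Capped b (x ∷ xs) = x ≤ b × Capped (pred b) xs

Desc : ℕ → List ℕ → Set
Desc m [] = ⊤
Desc m (x ∷ xs) = x ≤ m × Desc x xs

Desc-weaken : m ≤ v → Desc m as → Desc v as
Desc-weaken {as = []} _ _ = tt
Desc-weaken {as = x ∷ xs} m≤v (x≤m , desc) = ≤-trans x≤m m≤v , desc

Desc⇒All≤ : Desc m as → All (_≤ m) as
Desc⇒All≤ {as = []} _ = []
Desc⇒All≤ {as = x ∷ xs} (x≤m , desc) = x≤m ∷ All.map (λ y≤x → ≤-trans y≤x x≤m) (Desc⇒All≤ desc)

suc-pred-pos : 1 ≤ b → suc (pred b) ≡ b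
suc-pred-pos {suc b} _ = refl

pred+suc : ∀ {b} m → 1 ≤ b → pred b + suc m ≡ b + m
pred+suc {suc b} m _ = +-suc b m

CanPark-anti : x ≤ m → CanPark k n m y → CanPark k n x y
CanPark-anti x≤m (y-spot , m≤y+k) = y-spot , ≤-trans x≤m m≤y+k

capped⇒parks : ∀ occ as → All (IsSpot n) as → length occ + length as ≡ n →
               b + length occ ≡ n + k → Capped b as → T (is-just (parkAll k n occ as))
capped⇒parks occ [] _ _ _ _ = tt
capped⇒parks {n} {b} {k} occ (x ∷ xs) ((1≤x , _) ∷ spots) len budget (x≤b , capped)
  with parkOne k n occ x in eq
... | just y = capped⇒parks (y ∷ occ) xs spots (trans (sym (+-suc _ _)) len)
                 (trans (pred+suc _ (≤-trans 1≤x x≤b)) budget) capped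
-- Under the bound the top suc off spots are all reachable, hence all taken by only off cars.
... | nothing = 1+n≰n (≤-trans (≤-reflexive (sym (length-applyUpTo (n ∸_) (suc off))))
                               (Unique⇒length≤ (topSpots-unique off<n) top⊆occ))
  where
  off = length occ
  off<n : off < n
  off<n = ≤-trans (m<m+n off z<s) (≤-reflexive len)
  top⊆occ : topSpots n (suc off) ⊆ occ
  top⊆occ z∈ with i , i<1+off , refl ← ∈-applyUpTo⁻ (n ∸_) z∈ =
    parkOne-nothing eq ((m<n⇒0<n∸m i<n , m∸n≤m n i) , x≤n∸i+k)
    where
    i<n = ≤-trans i<1+off off<n
    x≤n∸i+k : x ≤ n ∸ i + k
    x≤n∸i+k = subst (x ≤_) (+-∸-comm k (<⇒≤ i<n)) (m+n≤o⇒m≤o∸n x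
      (≤-trans (+-mono-≤ x≤b (s≤s⁻¹ i<1+off)) (≤-reflexive budget)))

parks⇒capped : ∀ occ as → Unique occ → All (CanPark k n m) occ → Desc m as → All (IsSpot n) as →
               b + length occ ≡ n + k → T (is-just (parkAll k n occ as)) → Capped b as
parks⇒capped occ [] _ _ _ _ _ _ = tt
parks⇒capped {k} {n} {m} {b} occ (x ∷ xs) uocc parked (x≤m , desc) (x-spot@(1≤x , _) ∷ spots) budget ok
  with parkOne k n occ x in eq
... | nothing = ⊥-elim ok
... | just y with y∉ , y-ok ← parkOne-just x-spot eq =
  x≤b , parks⇒capped (y ∷ occ) xs uocc′ parked′ desc spots (trans (pred+suc _ (≤-trans 1≤x x≤b)) budget) ok
  where
  off = length occ
  uocc′ : Unique (y ∷ occ)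
  uocc′ = ¬Any⇒All¬ occ y∉ ∷ uocc
  parked′ : All (CanPark k n x) (y ∷ occ)
  parked′ = y-ok ∷ All.map (CanPark-anti x≤m) parked
  -- Were b < x, the suc off parked cars, all at spots ≥ x − k > b − k, would fit in the top off spots.
  x≤b : x ≤ b
  x≤b = ≮⇒≥ λ b<x → 1+n≰n (≤-trans (Unique⇒length≤ uocc′ (λ z∈ → in-top b<x (All.lookup parked′ z∈)))
                                    (≤-reflexive (length-applyUpTo (n ∸_) off)))
    where
    in-top : ∀ {z} → b < x → CanPark k n x z → z ∈ topSpots n off
    in-top {z} b<x ((_ , z≤max) , x≤z+k) =
      subst (_∈ _) (m∸[m∸n]≡n z≤max) (∈-applyUpTo⁺ (n ∸_) (+-cancelʳ-< b (n ∸ z) off (begin-strict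
        n ∸ z + b       <⟨ +-monoʳ-< (n ∸ z) b<x ⟩
        n ∸ z + x       ≤⟨ +-monoʳ-≤ (n ∸ z) x≤z+k ⟩
        n ∸ z + (z + k) ≡⟨ sym (+-assoc (n ∸ z) z k) ⟩
        n ∸ z + z + k   ≡⟨ cong (_+ k) (m∸n+n≡m z≤max) ⟩
        n + k           ≡⟨ sym budget ⟩
        b + off         ≡⟨ +-comm b off ⟩
        off + b         ∎)))
      where open ≤-Reasoning

capped⇒naples : length as ≡ n → All (IsSpot n) as → Capped (n + k) as → T (is-just (parkAll k n [] as))
capped⇒naples len spots = capped⇒parks [] _ spots len (+-identityʳ _)

naples⇒capped : Desc m as → All (IsSpot n) as → T (is-just (parkAll k n [] as)) → Capped (n + k) as
naples⇒capped desc spots = parks⇒capped [] _ [] [] desc spots (+-identityʳ _)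

Touches : ℕ → List ℕ → Set
Touches b [] = ⊥
Touches b (x ∷ xs) = x ≡ b ⊎ Touches (pred b) xs

Touches⇒¬Capped : ∀ as → All (1 ≤_) as → Touches (suc b) as → ¬ Capped b as
Touches⇒¬Capped (x ∷ xs) _ (inj₁ refl) (x≤b , _) = 1+n≰n x≤b
Touches⇒¬Capped {zero} (x ∷ xs) (1≤x ∷ _) (inj₂ _) (x≤0 , _) = 1+n≰n (≤-trans 1≤x x≤0)
Touches⇒¬Capped {suc b} (x ∷ xs) (_ ∷ pos) (inj₂ touch) (_ , capped) = Touches⇒¬Capped xs pos touch capped

¬Capped⇒Touches : ∀ as → All (1 ≤_) as → Capped (suc b) as → ¬ Capped b as → Touches (suc b) as
¬Capped⇒Touches [] _ _ ¬capped = ¬capped tt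
¬Capped⇒Touches {b} (x ∷ xs) (1≤x ∷ pos) (x≤1+b , capped) ¬capped with x ≤? b
... | no x≰b = inj₁ (≤-antisym x≤1+b (≰⇒> x≰b))
¬Capped⇒Touches {zero} (x ∷ xs) (1≤x ∷ pos) _ _ | yes x≤0 = contradiction (≤-trans 1≤x x≤0) 1+n≰n
¬Capped⇒Touches {suc b} (x ∷ xs) (1≤x ∷ pos) (_ , capped) ¬capped | yes x≤b =
  inj₂ (¬Capped⇒Touches xs pos capped (λ capped′ → ¬capped (x≤b , capped′)))

module _ {k n : ℕ} {as : List ℕ} (len : length as ≡ n) (ok : All (IsSpot n) as) (desc : Desc n as) where

  exactlyNaples⇒ : 1 ≤ k → T (is-just (parkAll k n [] as)) → ¬ T (is-just (parkAll (k ∸ 1) n [] as)) →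
                   Capped (n + k) as × Touches (n + k) as
  exactlyNaples⇒ (s≤s {n = k′} _) naples ¬naples′ =
    capped , subst (λ b → Touches b as) (sym (+-suc n k′))
      (¬Capped⇒Touches as (All.map proj₁ ok) (subst (λ b → Capped b as) (+-suc n k′) capped)
        (λ capped′ → ¬naples′ (capped⇒naples len ok capped′)))
    where
    capped = naples⇒capped desc ok naples

  exactlyNaples⇐ : 1 ≤ k → Capped (n + k) as → Touches (n + k) as →
                   T (is-just (parkAll k n [] as)) × ¬ T (is-just (parkAll (k ∸ 1) n [] as))
  exactlyNaples⇐ (s≤s {n = k′} _) capped touch =
    capped⇒naples len ok capped ,
    λ naples′ → Touches⇒¬Capped as (All.map proj₁ ok) (subst (λ b → Touches b as) (+-suc n k′) touch)
                  (naples⇒capped desc ok naples′)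

-- Lattice paths

ups downs : ℕ → List Bool
ups m = replicate m true
downs m = replicate m false

data Path : ℕ → List Bool → ℕ → Set where
  end  : Path h [] h
  up   : Path (suc h) s h′ → Path h (true ∷ s) h′
  down : Path h s h′ → Path (suc h) (false ∷ s) h′

T-dyckFrom⇒Path : ∀ h s → T (dyckFrom h s) → Path h s 0
T-dyckFrom⇒Path h [] ok rewrite ≡ᵇ⇒≡ h 0 ok = end
T-dyckFrom⇒Path h (true ∷ s) ok = up (T-dyckFrom⇒Path (suc h) s ok)
T-dyckFrom⇒Path (suc h) (false ∷ s) ok = down (T-dyckFrom⇒Path h s ok)

Path⇒T-dyckFrom : Path h s 0 → T (dyckFrom h s)
Path⇒T-dyckFrom end = tt
Path⇒T-dyckFrom (up p) = Path⇒T-dyckFrom p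
Path⇒T-dyckFrom (down p) = Path⇒T-dyckFrom p

_++ₚ_ : Path h s m → Path m t h′ → Path h (s ++ t) h′
end    ++ₚ q = q
up p   ++ₚ q = up (p ++ₚ q)
down p ++ₚ q = down (p ++ₚ q)

Path-++⁻ : ∀ s → Path h (s ++ t) h′ → ∃ λ m → Path h s m × Path m t h′
Path-++⁻ [] p = _ , end , p
Path-++⁻ (true ∷ s) (up p) with m , p₁ , p₂ ← Path-++⁻ s p = m , up p₁ , p₂
Path-++⁻ (false ∷ s) (down p) with m , p₁ , p₂ ← Path-++⁻ s p = m , down p₁ , p₂

Path-functional : Path h s m → Path h s h′ → m ≡ h′
Path-functional end end = refl
Path-functional (up p) (up q) = Path-functional p q
Path-functional (down p) (down q) = Path-functional p q

Path-drop : Path h s m → Path h (s ++ t) h′ → Path m t h′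
Path-drop {s = s} p pq with m′ , p′ , q ← Path-++⁻ s pq rewrite Path-functional p p′ = q

Path-ups : ∀ m h → Path h (ups m) (m + h)
Path-ups zero h = end
Path-ups (suc m) h = up (subst (Path (suc h) (ups m)) (+-suc m h) (Path-ups m (suc h)))

Path-downs : ∀ m h → Path (m + h) (downs m) h
Path-downs zero h = end
Path-downs (suc m) h = down (Path-downs m h)

Path-downs⁻ : ∀ m → Path v (downs m) h → v ≡ m + h
Path-downs⁻ zero end = refl
Path-downs⁻ (suc m) (down p) = cong suc (Path-downs⁻ m p)

mirror : List Bool → List Bool
mirror [] = []
mirror (c ∷ s) = mirror s ++ [ not c ]

mirror-++ : ∀ s t → mirror (s ++ t) ≡ mirror t ++ mirror s
mirror-++ [] t = sym (++-identityʳ (mirror t))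
mirror-++ (c ∷ s) t = begin
  mirror (s ++ t) ++ [ not c ]       ≡⟨ cong (_++ [ not c ]) (mirror-++ s t) ⟩
  (mirror t ++ mirror s) ++ [ not c ] ≡⟨ ++-assoc (mirror t) (mirror s) _ ⟩
  mirror t ++ mirror s ++ [ not c ]   ∎
  where open ≡-Reasoning

mirror-involutive : ∀ s → mirror (mirror s) ≡ s
mirror-involutive [] = refl
mirror-involutive (c ∷ s) rewrite mirror-++ (mirror s) [ not c ] | mirror-involutive s | not-involutive c = refl

Path-mirror : Path h s h′ → Path h′ (mirror s) h
Path-mirror end = end
Path-mirror (up p) = Path-mirror p ++ₚ down end
Path-mirror (down p) = Path-mirror p ++ₚ up end

#up #down : List Bool → ℕ
#up [] = 0
#up (true ∷ s) = suc (#up s)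
#up (false ∷ s) = #up s
#down [] = 0
#down (true ∷ s) = #down s
#down (false ∷ s) = suc (#down s)

length≡#up+#down : ∀ s → length s ≡ #up s + #down s
length≡#up+#down [] = refl
length≡#up+#down (true ∷ s) = cong suc (length≡#up+#down s)
length≡#up+#down (false ∷ s) = trans (cong suc (length≡#up+#down s)) (sym (+-suc (#up s) (#down s)))

Path-balance : Path h s h′ → h + #up s ≡ h′ + #down s
Path-balance {h} end = refl
Path-balance {h} (up {s = s} p) = trans (+-suc h (#up s)) (Path-balance p)
Path-balance {h′ = h′} (down {s = s} p) = trans (cong suc (Path-balance p)) (sym (+-suc h′ (#down s)))

length-mirror : ∀ s → length (mirror s) ≡ length s
length-mirror [] = refl
length-mirror (c ∷ s) = trans (length-++ (mirror s)) (trans (+-comm _ 1) (cong suc (length-mirror s)))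

HitsZero : ℕ → List Bool → Set
HitsZero h [] = ⊥
HitsZero h (c ∷ s) = stepH h c ≡ 0 ⊎ HitsZero (stepH h c) s

HitsZero-++ˡ : ∀ s → HitsZero h s → HitsZero h (s ++ t)
HitsZero-++ˡ (c ∷ s) (inj₁ hit) = inj₁ hit
HitsZero-++ˡ (c ∷ s) (inj₂ hit) = inj₂ (HitsZero-++ˡ s hit)

HitsZero-++ʳ : Path h s m → HitsZero m t → HitsZero h (s ++ t)
HitsZero-++ʳ end hit = hit
HitsZero-++ʳ (up p) hit = inj₂ (HitsZero-++ʳ p hit)
HitsZero-++ʳ (down p) hit = inj₂ (HitsZero-++ʳ p hit)

HitsZero-++⁻ : Path h s m → HitsZero h (s ++ t) → HitsZero h s ⊎ HitsZero m t
HitsZero-++⁻ end hit = inj₂ hit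
HitsZero-++⁻ (up p) (inj₂ hit) = Sum.map₁ inj₂ (HitsZero-++⁻ p hit)
HitsZero-++⁻ (down p) (inj₁ hit) = inj₁ (inj₁ hit)
HitsZero-++⁻ (down p) (inj₂ hit) = Sum.map₁ inj₂ (HitsZero-++⁻ p hit)

ups-¬HitsZero : ∀ m → ¬ HitsZero h (ups m)
ups-¬HitsZero (suc m) (inj₂ hit) = ups-¬HitsZero m hit

downs-¬HitsZero : ∀ m → m ≤ h → ¬ HitsZero (suc h) (downs m)
downs-¬HitsZero {suc h} (suc m) (s≤s m≤h) (inj₂ hit) = downs-¬HitsZero m m≤h hit

Path⇒HitsZero : Path (suc h) s 0 → HitsZero (suc h) s
Path⇒HitsZero (up p) = inj₂ (Path⇒HitsZero p)
Path⇒HitsZero {zero} (down p) = inj₁ refl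
Path⇒HitsZero {suc h} (down p) = inj₂ (Path⇒HitsZero p)

HitsZero⇒split : Path h s h′ → HitsZero h s →
                 ∃₂ λ s₁ s₂ → s ≡ s₁ ++ s₂ × Path h s₁ 0 × Path 0 s₂ h′
HitsZero⇒split (up p) (inj₂ hit) with s₁ , s₂ , refl , p₁ , p₂ ← HitsZero⇒split p hit =
  true ∷ s₁ , s₂ , refl , up p₁ , p₂
HitsZero⇒split (down p) (inj₁ refl) = false ∷ [] , _ , refl , down end , p
HitsZero⇒split (down p) (inj₂ hit) with s₁ , s₂ , refl , p₁ , p₂ ← HitsZero⇒split p hit =
  false ∷ s₁ , s₂ , refl , down p₁ , p₂

-- The mirrored path reaches 0 where the original did, and does so after a step since it starts at h′ > 0.
HitsZero-mirror : Path h s h′ → 1 ≤ h′ → HitsZero h s → HitsZero h′ (mirror s)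
HitsZero-mirror p (s≤s _) hit with s₁ , s₂ , refl , p₁ , p₂ ← HitsZero⇒split p hit
  rewrite mirror-++ s₁ s₂ = HitsZero-++ˡ (mirror s₂) (Path⇒HitsZero (Path-mirror p₂))

T-returnsBeforeLast⇒HitsZero : ∀ h s c → T (returnsBeforeLastFrom h (s ++ [ c ])) → HitsZero h s
T-returnsBeforeLast⇒HitsZero h (d ∷ []) c ok =
  Sum.map (≡ᵇ⇒≡ _ 0) (λ ()) (T-∨ .to ok)
T-returnsBeforeLast⇒HitsZero h (d ∷ e ∷ s) c ok =
  Sum.map (≡ᵇ⇒≡ _ 0) (T-returnsBeforeLast⇒HitsZero (stepH h d) (e ∷ s) c) (T-∨ .to ok)

HitsZero⇒T-returnsBeforeLast : ∀ h s c → HitsZero h s → T (returnsBeforeLastFrom h (s ++ [ c ]))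
HitsZero⇒T-returnsBeforeLast h (d ∷ []) c hit = T-∨ .from (Sum.map (≡⇒≡ᵇ _ 0) (λ ()) hit)
HitsZero⇒T-returnsBeforeLast h (d ∷ e ∷ s) c hit =
  T-∨ .from (Sum.map (≡⇒≡ᵇ _ 0) (HitsZero⇒T-returnsBeforeLast (stepH h d) (e ∷ s) c) hit)

-- The staircase of a descending list

stairs : ℕ → List ℕ → List Bool
stairs w [] = ups (w ∸ 1)
stairs w (x ∷ xs) = ups (w ∸ x) ++ false ∷ stairs x xs

unstairs : ℕ → List Bool → List ℕ
unstairs v [] = []
unstairs v (true ∷ s) = unstairs (v ∸ 1) s
unstairs v (false ∷ s) = v ∷ unstairs v s

unstairs-ups : ∀ m v → unstairs v (ups m ++ s) ≡ unstairs (v ∸ m) s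
unstairs-ups zero v = refl
unstairs-ups {s} (suc m) v = trans (unstairs-ups m (v ∸ 1)) (cong (λ u → unstairs u s) (∸-+-assoc v 1 m))

unstairs-ups-[] : ∀ m v → unstairs v (ups m) ≡ []
unstairs-ups-[] zero v = refl
unstairs-ups-[] (suc m) v = unstairs-ups-[] m (v ∸ 1)

unstairs-stairs : ∀ as → Desc w as → unstairs w (stairs w as) ≡ as
unstairs-stairs {w} [] _ = unstairs-ups-[] (w ∸ 1) w
unstairs-stairs {w} (x ∷ xs) (x≤w , desc)
  rewrite unstairs-ups {false ∷ stairs x xs} (w ∸ x) w | m∸[m∸n]≡n x≤w = cong (x ∷_) (unstairs-stairs xs desc)

unstairs-Desc : ∀ v s → Desc v (unstairs v s)
unstairs-Desc v [] = tt
unstairs-Desc v (true ∷ s) = Desc-weaken (m∸n≤m v 1) (unstairs-Desc (v ∸ 1) s)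
unstairs-Desc v (false ∷ s) = ≤-refl , unstairs-Desc v s

unstairs-positive : ∀ v s → #up s < v → All (1 ≤_) (unstairs v s)
unstairs-positive v [] _ = []
unstairs-positive (suc v) (true ∷ s) (s≤s up<v) = unstairs-positive v s up<v
unstairs-positive v (false ∷ s) up<v = ≤-trans (s≤s z≤n) up<v ∷ unstairs-positive v s up<v

length-unstairs : ∀ v s → length (unstairs v s) ≡ #down s
length-unstairs v [] = refl
length-unstairs v (true ∷ s) = length-unstairs (v ∸ 1) s
length-unstairs v (false ∷ s) = cong suc (length-unstairs v s)

stairs-suc : ∀ as → 1 ≤ w → All (_≤ w) as → stairs (suc w) as ≡ true ∷ stairs w as
stairs-suc {suc w} [] _ _ = refl
stairs-suc (x ∷ xs) _ (x≤w ∷ _) rewrite +-∸-assoc 1 x≤w = refl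

stairs-unstairs : ∀ w s → #up s + 1 ≡ w → stairs w (unstairs w s) ≡ s
stairs-unstairs w [] refl = refl
stairs-unstairs w (false ∷ s) ups≡ rewrite n∸n≡0 w = cong (false ∷_) (stairs-unstairs w s ups≡)
stairs-unstairs (suc w) (true ∷ s) ups≡ = begin
  stairs (suc w) (unstairs w s) ≡⟨ stairs-suc (unstairs w s) 1≤w (Desc⇒All≤ (unstairs-Desc w s)) ⟩
  true ∷ stairs w (unstairs w s) ≡⟨ cong (true ∷_) (stairs-unstairs w s ups≡′) ⟩
  true ∷ s                       ∎
  where
  open ≡-Reasoning
  ups≡′ = suc-injective ups≡
  1≤w = subst (1 ≤_) ups≡′ (m≤n+m 1 (#up s))

-- Read from height h with h + w ≡ suc b, the block of entry x in `stairs w` climbs to suc (b ∸ x)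
-- and its down step lands at b ∸ x, where the next block starts with budget pred b.
block-climb : x ≤ w → h + w ≡ suc b → w ∸ x + h + x ≡ suc b
block-climb {x} {w} {h} x≤w hw = begin
  w ∸ x + h + x   ≡⟨ +-assoc (w ∸ x) h x ⟩
  w ∸ x + (h + x) ≡⟨ cong (w ∸ x +_) (+-comm h x) ⟩
  w ∸ x + (x + h) ≡⟨ sym (+-assoc (w ∸ x) x h) ⟩
  w ∸ x + x + h   ≡⟨ cong (_+ h) (m∸n+n≡m x≤w) ⟩
  w + h           ≡⟨ +-comm w h ⟩
  h + w           ≡⟨ hw ⟩
  _               ∎
  where open ≡-Reasoning

block-top : x ≤ w → x ≤ b → h + w ≡ suc b → w ∸ x + h ≡ suc (b ∸ x)
block-top {x} {b = b} x≤w x≤b hw =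
  +-cancelʳ-≡ x _ _ (trans (block-climb x≤w hw) (cong suc (sym (m∸n+n≡m x≤b))))

block-next : 1 ≤ x → x ≤ b → b ∸ x + x ≡ suc (pred b)
block-next 1≤x x≤b = trans (m∸n+n≡m x≤b) (sym (suc-pred-pos (≤-trans 1≤x x≤b)))

stairs-Path : ∀ as → h + w ≡ suc b → l + length as ≡ b → 1 ≤ w → Desc w as → All (1 ≤_) as →
              Capped b as → Path h (stairs w as) l
stairs-Path {h} {w} {l = l} [] hw l≡ 1≤w _ _ _ =
  subst (Path h (ups (w ∸ 1))) w∸1+h≡l (Path-ups (w ∸ 1) h)
  where
  w∸1+h≡l : w ∸ 1 + h ≡ l
  w∸1+h≡l = +-cancelʳ-≡ 1 _ _ (trans (block-climb 1≤w hw) (trans (cong suc (sym l≡)) (sym (+-suc l 0))))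
stairs-Path {h} {w} {b} {l} (x ∷ xs) hw l≡ _ (x≤w , desc) (1≤x ∷ pos) (x≤b , capped) =
  subst (Path h (ups (w ∸ x))) (block-top x≤w x≤b hw) (Path-ups (w ∸ x) h)
  ++ₚ down (stairs-Path xs (block-next 1≤x x≤b) l≡′ 1≤x desc pos capped)
  where
  l≡′ : l + length xs ≡ pred b
  l≡′ = cong pred (trans (sym (+-suc l (length xs))) l≡)

Path-stairs⇒Capped : ∀ as → h + w ≡ suc b → Desc w as → All (1 ≤_) as → Path h (stairs w as) l → Capped b as
Path-stairs⇒Capped [] _ _ _ _ = tt
Path-stairs⇒Capped {h} {w} {b} (x ∷ xs) hw (x≤w , desc) (1≤x ∷ pos) p
  with _ , p₁ , down {h = r} q ← Path-++⁻ (ups (w ∸ x)) p =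
  x≤b , Path-stairs⇒Capped xs (trans r+x≡b (sym (suc-pred-pos (≤-trans 1≤x x≤b)))) desc pos q
  where
  r+x≡b : r + x ≡ b
  r+x≡b = suc-injective (trans (cong (_+ x) (Path-functional p₁ (Path-ups (w ∸ x) h))) (block-climb x≤w hw))
  x≤b : x ≤ b
  x≤b = subst (x ≤_) r+x≡b (m≤n+m x r)

stairs-HitsZero : ∀ as → h + w ≡ suc b → Desc w as → All (1 ≤_) as → Capped b as →
                  Touches b as → HitsZero h (stairs w as)
stairs-HitsZero {h} {w} {b} (x ∷ xs) hw (x≤w , desc) (1≤x ∷ pos) (x≤b , capped) touch =
  HitsZero-++ʳ (Path-ups (w ∸ x) h)
    (subst (λ z → HitsZero z (false ∷ stairs x xs)) (sym (block-top x≤w x≤b hw)) (hit touch))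
  where
  hit : Touches b (x ∷ xs) → HitsZero (suc (b ∸ x)) (false ∷ stairs x xs)
  hit (inj₁ refl) = inj₁ (n∸n≡0 x)
  hit (inj₂ touch′) = inj₂ (stairs-HitsZero xs (block-next 1≤x x≤b) desc pos capped touch′)

HitsZero-stairs⇒Touches : ∀ as → h + w ≡ suc b → Desc w as → All (1 ≤_) as → Capped b as →
                          HitsZero h (stairs w as) → Touches b as
HitsZero-stairs⇒Touches {h} {w} [] _ _ _ _ hit = ups-¬HitsZero (w ∸ 1) hit
HitsZero-stairs⇒Touches {h} {w} {b} (x ∷ xs) hw (x≤w , desc) (1≤x ∷ pos) (x≤b , capped) hit
  with HitsZero-++⁻ (Path-ups (w ∸ x) h) hit
... | inj₁ hit-ups = contradiction hit-ups (ups-¬HitsZero (w ∸ x))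
... | inj₂ hit-rest with subst (λ z → HitsZero z (false ∷ stairs x xs)) (block-top x≤w x≤b hw) hit-rest
...   | inj₁ b∸x≡0 = inj₁ (≤-antisym x≤b (m∸n≡0⇒m≤n b∸x≡0))
...   | inj₂ hit′ = inj₂ (HitsZero-stairs⇒Touches xs (block-next 1≤x x≤b) desc pos capped hit′)

-- Framed paths

module _ {A : Set} where

  replicate-∷ʳ : ∀ m (c : A) → replicate m c ++ [ c ] ≡ c ∷ replicate m c
  replicate-∷ʳ zero c = refl
  replicate-∷ʳ (suc m) c = cong (c ∷_) (replicate-∷ʳ m c)

  reverse-replicate : ∀ m (c : A) → reverse (replicate m c) ≡ replicate m c
  reverse-replicate zero c = refl
  reverse-replicate (suc m) c = begin
    reverse (c ∷ replicate m c)      ≡⟨ unfold-reverse c (replicate m c) ⟩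
    reverse (replicate m c) ++ [ c ] ≡⟨ cong (_++ [ c ]) (reverse-replicate m c) ⟩
    replicate m c ++ [ c ]           ≡⟨ replicate-∷ʳ m c ⟩
    c ∷ replicate m c                ∎
    where open ≡-Reasoning

  take-replicate-++ : ∀ m (c : A) ys → take m (replicate m c ++ ys) ≡ replicate m c
  take-replicate-++ zero c ys = refl
  take-replicate-++ (suc m) c ys = cong (c ∷_) (take-replicate-++ m c ys)

  drop-replicate-++ : ∀ m (c : A) ys → drop m (replicate m c ++ ys) ≡ ys
  drop-replicate-++ zero c ys = refl
  drop-replicate-++ (suc m) c ys = drop-replicate-++ m c ys

  take-++ˡ : ∀ m (xs ys : List A) → m ≤ length xs → take m (xs ++ ys) ≡ take m xs
  take-++ˡ zero xs ys _ = refl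
  take-++ˡ (suc m) (x ∷ xs) ys (s≤s m≤) = cong (x ∷_) (take-++ˡ m xs ys m≤)

  all-replicate : ∀ (p : A → Bool) m {c} → T (p c) → T (all p (replicate m c))
  all-replicate p zero _ = _
  all-replicate p (suc m) pc = T-∧ .from (pc , all-replicate p m pc)

  all-take⇒replicate : ∀ {p : A → Bool} {c} → (∀ {d} → T (p d) → d ≡ c) →
    ∀ m xs → m ≤ length xs → T (all p (take m xs)) → xs ≡ replicate m c ++ drop m xs
  all-take⇒replicate _ zero xs _ _ = refl
  all-take⇒replicate p⇒c (suc m) (x ∷ xs) (s≤s m≤) ok with px , ok′ ← T-∧ .to ok =
    cong₂ _∷_ (p⇒c px) (all-take⇒replicate p⇒c m xs m≤ ok′)

Framed : ℕ → List Bool → List Bool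
Framed k X = ups k ++ X ++ downs (suc k)

interior : ℕ → List Bool → List Bool
interior k P = reverse (drop (suc k) (reverse (drop k P)))

reverse-Framed : ∀ k X → reverse (Framed k X) ≡ downs (suc k) ++ reverse X ++ ups k
reverse-Framed k X = begin
  reverse (ups k ++ X ++ downs (suc k))            ≡⟨ reverse-++ (ups k) _ ⟩
  reverse (X ++ downs (suc k)) ++ reverse (ups k)  ≡⟨ cong₂ _++_ (reverse-++ X _) (reverse-replicate k true) ⟩
  (reverse (downs (suc k)) ++ reverse X) ++ ups k  ≡⟨ cong (λ D → (D ++ reverse X) ++ ups k) (reverse-replicate (suc k) false) ⟩
  (downs (suc k) ++ reverse X) ++ ups k            ≡⟨ ++-assoc (downs (suc k)) (reverse X) (ups k) ⟩
  downs (suc k) ++ reverse X ++ ups k              ∎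
  where open ≡-Reasoning

interior-Framed : ∀ k X → interior k (Framed k X) ≡ X
interior-Framed k X = begin
  reverse (drop (suc k) (reverse (drop k (ups k ++ X ++ downs (suc k)))))
    ≡⟨ cong (λ Q → reverse (drop (suc k) (reverse Q))) (drop-replicate-++ k true (X ++ downs (suc k))) ⟩
  reverse (drop (suc k) (reverse (X ++ downs (suc k))))
    ≡⟨ cong (λ Q → reverse (drop (suc k) Q)) (reverse-++ X (downs (suc k))) ⟩
  reverse (drop (suc k) (reverse (downs (suc k)) ++ reverse X))
    ≡⟨ cong (λ D → reverse (drop (suc k) (D ++ reverse X))) (reverse-replicate (suc k) false) ⟩
  reverse (drop (suc k) (downs (suc k) ++ reverse X))
    ≡⟨ cong reverse (drop-replicate-++ (suc k) false (reverse X)) ⟩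
  reverse (reverse X)
    ≡⟨ reverse-involutive X ⟩
  X ∎
  where open ≡-Reasoning

Framed-interior : ∀ k P → suc (k + k) ≤ length P → T (all (λ d → d) (take k P)) →
                  T (all not (take (suc k) (reverse P))) → P ≡ Framed k (interior k P)
Framed-interior k P long prefix suffix = begin
  P                                         ≡⟨ P≡ ⟩
  ups k ++ P₁                               ≡⟨ cong (ups k ++_) (sym (reverse-involutive P₁)) ⟩
  ups k ++ reverse (reverse P₁)             ≡⟨ cong (λ Q → ups k ++ reverse Q) rP₁≡ ⟩
  ups k ++ reverse (downs (suc k) ++ R)     ≡⟨ cong (ups k ++_) (reverse-++ (downs (suc k)) R) ⟩
  ups k ++ reverse R ++ reverse (downs (suc k)) ≡⟨ cong (λ D → ups k ++ reverse R ++ D) (reverse-replicate (suc k) false) ⟩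
  Framed k (interior k P)                   ∎
  where
  open ≡-Reasoning
  P₁ = drop k P
  R = drop (suc k) (reverse P₁)
  P≡ : P ≡ ups k ++ P₁
  P≡ = all-take⇒replicate (T-≡ .to) k P (≤-trans (m≤m+n k k) (≤-trans (n≤1+n _) long)) prefix
  long₁ : suc k ≤ length (reverse P₁)
  long₁ rewrite length-reverse P₁ | length-drop k P = m+n≤o⇒m≤o∸n (suc k) long
  suffix₁ : T (all not (take (suc k) (reverse P₁)))
  suffix₁ = subst (λ Q → T (all not Q)) (take-++ˡ (suc k) (reverse P₁) (reverse (ups k)) long₁)
              (subst (λ Q → T (all not (take (suc k) Q))) (trans (cong reverse P≡) (reverse-++ (ups k) P₁)) suffix)
  rP₁≡ : reverse P₁ ≡ downs (suc k) ++ R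
  rP₁≡ = all-take⇒replicate (T-not-≡ .to) (suc k) (reverse P₁) long₁ suffix₁

Path-ups₀ : ∀ k → Path 0 (ups k) k
Path-ups₀ k = subst (Path 0 (ups k)) (+-identityʳ k) (Path-ups k 0)

Path-downs₀ : ∀ k → Path k (downs k) 0
Path-downs₀ k = subst (λ h → Path h (downs k) 0) (+-identityʳ k) (Path-downs k 0)

Path-Framed : Path k X (suc k) → Path 0 (Framed k X) 0
Path-Framed {k} p = Path-ups₀ k ++ₚ (p ++ₚ Path-downs₀ (suc k))

Path-Framed⁻ : Path 0 (Framed k X) 0 → Path k X (suc k)
Path-Framed⁻ {k} {X} p with m , q , q′ ← Path-++⁻ X (Path-drop (Path-ups₀ k) p) =
  subst (Path k X) (trans (Path-downs⁻ (suc k) q′) (+-identityʳ (suc k))) q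

Framed-∷ʳ : ∀ k X → Framed k X ≡ (ups k ++ X ++ downs k) ++ [ false ]
Framed-∷ʳ k X = begin
  ups k ++ X ++ downs (suc k)           ≡⟨ cong (λ D → ups k ++ X ++ D) (sym (replicate-∷ʳ k false)) ⟩
  ups k ++ X ++ downs k ++ [ false ]    ≡⟨ cong (ups k ++_) (sym (++-assoc X (downs k) _)) ⟩
  ups k ++ (X ++ downs k) ++ [ false ]  ≡⟨ sym (++-assoc (ups k) (X ++ downs k) _) ⟩
  (ups k ++ X ++ downs k) ++ [ false ]  ∎
  where open ≡-Reasoning

HitsZero-Framed : HitsZero k X → T (returnsBeforeLastFrom 0 (Framed k X))
HitsZero-Framed {k} {X} hit rewrite Framed-∷ʳ k X =
  HitsZero⇒T-returnsBeforeLast 0 (ups k ++ X ++ downs k) false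
    (HitsZero-++ʳ (Path-ups₀ k) (HitsZero-++ˡ X hit))

HitsZero-Framed⁻ : Path k X (suc k) → T (returnsBeforeLastFrom 0 (Framed k X)) → HitsZero k X
HitsZero-Framed⁻ {k} {X} p ok rewrite Framed-∷ʳ k X
  with HitsZero-++⁻ (Path-ups₀ k) (T-returnsBeforeLast⇒HitsZero 0 (ups k ++ X ++ downs k) false ok)
... | inj₁ hit-ups = contradiction hit-ups (ups-¬HitsZero k)
... | inj₂ hit with HitsZero-++⁻ p hit
...   | inj₁ hit-X = hit-X
...   | inj₂ hit-downs = contradiction hit-downs (downs-¬HitsZero k ≤-refl)

Framed-target : Path k X (suc k) → HitsZero k X → T (isTargetPath k (Framed k X))
Framed-target {k} {X} p hit =
  T-∧ .from (Path⇒T-dyckFrom (Path-Framed p) , T-∧ .from (prefix , T-∧ .from (suffix , HitsZero-Framed hit)))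
  where
  prefix : T (all (λ d → d) (take k (Framed k X)))
  prefix = subst (λ Q → T (all (λ d → d) Q)) (sym (take-replicate-++ k true (X ++ downs (suc k))))
             (all-replicate (λ d → d) k _)
  suffix : T (all not (take (suc k) (reverse (Framed k X))))
  suffix = subst (λ Q → T (all not (take (suc k) Q))) (sym (reverse-Framed k X))
             (subst (λ Q → T (all not Q)) (sym (take-replicate-++ (suc k) false (reverse X ++ ups k)))
               (all-replicate not (suc k) _))

T-isTargetPath⁻ : T (isTargetPath k P) →
  T (isDyck P) × T (all (λ d → d) (take k P)) × T (all not (take (suc k) (reverse P))) × T (returnsBeforeLastFrom 0 P)
T-isTargetPath⁻ ok with dyck , ok₁ ← T-∧ .to ok with prefix , ok₂ ← T-∧ .to ok₁ =
  dyck , prefix , T-∧ .to ok₂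

Framed-target⁻ : T (isTargetPath k (Framed k X)) → Path k X (suc k) × HitsZero k X
Framed-target⁻ {k} {X} ok with dyck , _ , _ , returns ← T-isTargetPath⁻ {k} {Framed k X} ok =
  p , HitsZero-Framed⁻ p returns
  where
  p = Path-Framed⁻ (T-dyckFrom⇒Path 0 (Framed k X) dyck)

-- Encoding and decoding

encode : ℕ → ℕ → List ℕ → List Bool
encode k n as = Framed k (mirror (stairs n as))

decode : ℕ → ℕ → List Bool → List ℕ
decode k n P = unstairs n (mirror (interior k P))

#down-ups : ∀ m → #down (ups m) ≡ 0
#down-ups zero = refl
#down-ups (suc m) = #down-ups m

#down-ups-++ : ∀ m → #down (ups m ++ t) ≡ #down t
#down-ups-++ zero = refl
#down-ups-++ (suc m) = #down-ups-++ m

#down-stairs : ∀ w as → #down (stairs w as) ≡ length as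
#down-stairs w [] = #down-ups (w ∸ 1)
#down-stairs w (x ∷ xs) = trans (#down-ups-++ (w ∸ x)) (cong suc (#down-stairs x xs))

#down≡suc#up : Path (suc h) S h → #down S ≡ suc (#up S)
#down≡suc#up {h} {S} p = +-cancelˡ-≡ h _ _ (trans (sym (Path-balance p)) (sym (+-suc h (#up S))))

length-Framed-mirror : Path (suc k) S k → length (Framed k (mirror S)) ≡ 2 * (#down S + k)
length-Framed-mirror {k} {S} p = begin
  length (ups k ++ mirror S ++ downs (suc k))    ≡⟨ length-++ (ups k) ⟩
  length (ups k) + length (mirror S ++ downs (suc k)) ≡⟨ cong₂ _+_ (length-replicate k) (length-++ (mirror S)) ⟩
  k + (length (mirror S) + length (downs (suc k))) ≡⟨ cong (λ l → k + (l + length (downs (suc k)))) (length-mirror S) ⟩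
  k + (length S + length (downs (suc k)))        ≡⟨ cong₂ (λ l l′ → k + (l + l′)) (length≡#up+#down S) (length-replicate (suc k)) ⟩
  k + (#up S + #down S + suc k)                  ≡⟨ cong (λ d → k + (#up S + d + suc k)) down≡ ⟩
  k + (#up S + suc (#up S) + suc k)              ≡⟨ double k (#up S) ⟩
  2 * (suc (#up S) + k)                          ≡⟨ cong (λ d → 2 * (d + k)) (sym down≡) ⟩
  2 * (#down S + k)                              ∎
  where
  open ≡-Reasoning
  double : ∀ k u → k + (u + suc u + suc k) ≡ 2 * (suc u + k)
  double = solve-∀
  down≡ = #down≡suc#up p

decode-encode : ∀ k → Desc n as → decode k n (encode k n as) ≡ as
decode-encode {n} {as} k desc = begin
  unstairs n (mirror (interior k (Framed k (mirror (stairs n as))))) ≡⟨ cong (λ X → unstairs n (mirror X)) (interior-Framed k _) ⟩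
  unstairs n (mirror (mirror (stairs n as)))                       ≡⟨ cong (unstairs n) (mirror-involutive (stairs n as)) ⟩
  unstairs n (stairs n as)                                         ≡⟨ unstairs-stairs as desc ⟩
  as                                                               ∎
  where open ≡-Reasoning

stairs-start : ∀ k n → suc k + n ≡ suc (n + k)
stairs-start k n = cong suc (+-comm k n)

module _ {k n : ℕ} {as : List ℕ} (len : length as ≡ n) (desc : Desc n as) (pos : All (1 ≤_) as) where

  Capped⇒Path-stairs : 1 ≤ n → Capped (n + k) as → Path (suc k) (stairs n as) k
  Capped⇒Path-stairs 1≤n = stairs-Path as (stairs-start k n) (trans (cong (k +_) len) (+-comm k n)) 1≤n desc pos

  encode-target : 1 ≤ k → 1 ≤ n → Capped (n + k) as → Touches (n + k) as → T (isTargetPath k (encode k n as))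
  encode-target 1≤k 1≤n capped touch = Framed-target (Path-mirror p) (HitsZero-mirror p 1≤k hit)
    where
    p = Capped⇒Path-stairs 1≤n capped
    hit = stairs-HitsZero as (stairs-start k n) desc pos capped touch

  length-encode : 1 ≤ n → Capped (n + k) as → length (encode k n as) ≡ 2 * (n + k)
  length-encode 1≤n capped = trans (length-Framed-mirror (Capped⇒Path-stairs 1≤n capped))
    (cong (λ d → 2 * (d + k)) (trans (#down-stairs n as) len))

encode-target⁻ : ∀ k → Desc n as → All (1 ≤_) as → T (isTargetPath k (encode k n as)) →
                 Capped (n + k) as × Touches (n + k) as
encode-target⁻ {n} {as} k desc pos ok with p , hit ← Framed-target⁻ ok = capped , touch
  where
  pS : Path (suc k) (stairs n as) k
  pS = subst (λ s → Path (suc k) s k) (mirror-involutive (stairs n as)) (Path-mirror p)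
  capped = Path-stairs⇒Capped as (stairs-start k n) desc pos pS
  touch = HitsZero-stairs⇒Touches as (stairs-start k n) desc pos capped
            (subst (HitsZero (suc k)) (mirror-involutive (stairs n as)) (HitsZero-mirror p (s≤s z≤n) hit))

module _ {k n : ℕ} (P : List Bool) (1≤n : 1 ≤ n) (len : length P ≡ 2 * (n + k)) (target : T (isTargetPath k P)) where
  private
    inner = interior k P
    mid = mirror inner

    P≡Framed : P ≡ Framed k inner
    P≡Framed with _ , prefix , suffix , _ ← T-isTargetPath⁻ {k} {P} target =
      Framed-interior k P (subst (suc (k + k) ≤_) (sym len) long) prefix suffix
      where
      long : suc (k + k) ≤ 2 * (n + k)
      long = ≤-trans (+-monoˡ-≤ (k + k) (≤-trans 1≤n (m≤m+n n n))) (≤-reflexive (sym (double n k)))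
        where
        double : ∀ n k → 2 * (n + k) ≡ n + n + (k + k)
        double = solve-∀

    pS : Path (suc k) mid k
    pS = Path-mirror (proj₁ (Framed-target⁻ (subst (λ Q → T (isTargetPath k Q)) P≡Framed target)))

    #down≡n : #down mid ≡ n
    #down≡n = +-cancelʳ-≡ k _ _ (*-cancelˡ-≡ _ _ 2 (begin
      2 * (#down mid + k)             ≡⟨ sym (length-Framed-mirror pS) ⟩
      length (Framed k (mirror mid))  ≡⟨ cong (λ Y → length (Framed k Y)) (mirror-involutive inner) ⟩
      length (Framed k inner)           ≡⟨ cong length (sym P≡Framed) ⟩
      length P                      ≡⟨ len ⟩
      2 * (n + k)                   ∎))
      where open ≡-Reasoning

    #up+1≡n : #up mid + 1 ≡ n
    #up+1≡n = trans (+-comm (#up mid) 1) (trans (sym (#down≡suc#up pS)) #down≡n)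

  length-decode : length (decode k n P) ≡ n
  length-decode = trans (length-unstairs n mid) #down≡n

  decode-Desc : Desc n (decode k n P)
  decode-Desc = unstairs-Desc n mid

  decode-positive : All (1 ≤_) (decode k n P)
  decode-positive = unstairs-positive n mid (subst (#up mid <_) #up+1≡n (m<m+n (#up mid) (s≤s z≤n)))

  encode-decode : encode k n (decode k n P) ≡ P
  encode-decode = begin
    Framed k (mirror (stairs n (unstairs n mid))) ≡⟨ cong (λ Y → Framed k (mirror Y)) (stairs-unstairs n mid #up+1≡n) ⟩
    Framed k (mirror (mirror inner))            ≡⟨ cong (Framed k) (mirror-involutive inner) ⟩
    Framed k inner                              ≡⟨ sym P≡Framed ⟩
    P                                           ∎
    where open ≡-Reasoning

-- Preference vectors and the bijection

spots : Vec (Fin n) m → List ℕ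
spots v = map (λ i → suc (toℕ i)) (toList v)

length-spots : (v : Vec (Fin n) m) → length (spots v) ≡ m
length-spots [] = refl
length-spots (i ∷ v) = cong suc (length-spots v)

spots-IsSpot : (v : Vec (Fin n) m) → All (IsSpot n) (spots v)
spots-IsSpot [] = []
spots-IsSpot (i ∷ v) = (s≤s z≤n , toℕ<n i) ∷ spots-IsSpot v

toList-injective′ : ∀ {A : Set} (u v : Vec A m) → toList u ≡ toList v → u ≡ v
toList-injective′ u v eq = trans (sym (cast-is-id refl u)) (toList-injective refl u v eq)

spots-injective : (u v : Vec (Fin n) m) → spots u ≡ spots v → u ≡ v
spots-injective u v eq = toList-injective′ u v (map-injective (λ eq′ → toℕ-injective (suc-injective eq′)) eq)

fromSpots : ∀ as → All (IsSpot n) as → Vec (Fin n) (length as)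
fromSpots [] [] = []
fromSpots (suc x ∷ xs) ((_ , x<n) ∷ ok) = fromℕ< x<n ∷ fromSpots xs ok

spots-fromSpots : ∀ as (ok : All (IsSpot n) as) → spots (fromSpots as ok) ≡ as
spots-fromSpots [] [] = refl
spots-fromSpots (suc x ∷ xs) ((_ , x<n) ∷ ok) = cong₂ _∷_ (cong suc (toℕ-fromℕ< x<n)) (spots-fromSpots xs ok)

spots-cast : ∀ {m′} .(eq : m ≡ m′) (v : Vec (Fin n) m) → spots (cast eq v) ≡ spots v
spots-cast eq v = cong (map _) (toList-cast eq v)

Desc-descendingL : ∀ {x} xs → T (descendingL (x ∷ xs)) → Desc x xs
Desc-descendingL [] _ = _
Desc-descendingL (y ∷ xs) ok with y≤x , ok′ ← T-∧ .to ok = ≤ᵇ⇒≤ _ _ y≤x , Desc-descendingL xs ok′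

descendingL-Desc : ∀ {x} xs → Desc x xs → T (descendingL (x ∷ xs))
descendingL-Desc [] _ = _
descendingL-Desc (y ∷ xs) (y≤x , desc) = T-∧ .from (≤⇒≤ᵇ y≤x , descendingL-Desc xs desc)

T-descendingL⇒Desc : ∀ as → All (_≤ m) as → T (descendingL as) → Desc m as
T-descendingL⇒Desc [] _ _ = _
T-descendingL⇒Desc (x ∷ xs) (x≤m ∷ _) ok = x≤m , Desc-descendingL xs ok

Desc⇒T-descendingL : ∀ as → Desc m as → T (descendingL as)
Desc⇒T-descendingL [] _ = _
Desc⇒T-descendingL (x ∷ xs) (_ , desc) = descendingL-Desc xs desc

T-not⇒¬T : ∀ b → T (not b) → ¬ T b
T-not⇒¬T false _ ()

¬T⇒T-not : ∀ b → ¬ T b → T (not b)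
¬T⇒T-not false _ = _
¬T⇒T-not true ¬t = ¬t _

vecOfSpots : ∀ as → length as ≡ m → All (IsSpot n) as → Vec (Fin n) m
vecOfSpots as len ok = cast len (fromSpots as ok)

spots-vecOfSpots : ∀ as (len : length as ≡ m) (ok : All (IsSpot n) as) → spots (vecOfSpots as len ok) ≡ as
spots-vecOfSpots as len ok = trans (spots-cast len (fromSpots as ok)) (spots-fromSpots as ok)

vecOfList : ∀ {A : Set} (xs : List A) → length xs ≡ m → Vec A m
vecOfList xs len = cast len (fromList xs)

toList-vecOfList : ∀ {A : Set} (xs : List A) (len : length xs ≡ m) → toList (vecOfList xs len) ≡ xs
toList-vecOfList xs len = trans (toList-cast len (fromList xs)) (toList∘fromList xs)

module Bijection (k n : ℕ) (1≤k : 1 ≤ k) (1≤n : 1 ≤ n) where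

  IsSource : Vec (Fin n) n → Set
  IsSource a = T (isDescending a ∧ isNaplesPF k a ∧ not (isNaplesPF (k ∸ 1) a))

  IsTarget : Vec Bool (2 * (n + k)) → Set
  IsTarget p = T (isTargetPath k (toList p))

  Tight : List ℕ → Set
  Tight as = Desc n as × Capped (n + k) as × Touches (n + k) as

  IsSource⇒Tight : ∀ a → IsSource a → Tight (spots a)
  IsSource⇒Tight a ok with descending , ok′ ← T-∧ .to ok with naples , not-naples′ ← T-∧ .to ok′ =
    desc , exactlyNaples⇒ (length-spots a) (spots-IsSpot a) desc 1≤k naples (T-not⇒¬T _ not-naples′)
    where
    desc = T-descendingL⇒Desc (spots a) (All.map proj₂ (spots-IsSpot a)) descending

  Tight⇒IsSource : ∀ a → Tight (spots a) → IsSource a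
  Tight⇒IsSource a (desc , capped , touch)
    with naples , ¬naples′ ← exactlyNaples⇐ (length-spots a) (spots-IsSpot a) desc 1≤k capped touch =
    T-∧ .from (Desc⇒T-descendingL _ desc , T-∧ .from (naples , ¬T⇒T-not _ ¬naples′))

  module _ (a : Vec (Fin n) n) (ok : IsSource a) where

    private
      desc = proj₁ (IsSource⇒Tight a ok)
      capped = proj₁ (proj₂ (IsSource⇒Tight a ok))
      touch = proj₂ (proj₂ (IsSource⇒Tight a ok))
      pos = All.map proj₁ (spots-IsSpot a)

    length-encode-spots : length (encode k n (spots a)) ≡ 2 * (n + k)
    length-encode-spots = length-encode (length-spots a) desc pos 1≤n capped

    encode-spots-target : T (isTargetPath k (encode k n (spots a)))
    encode-spots-target = encode-target (length-spots a) desc pos 1≤k 1≤n capped touch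

  module _ (p : Vec Bool (2 * (n + k))) (ok : IsTarget p) where

    private
      lenP = length-toList p
      desc = decode-Desc (toList p) 1≤n lenP ok
      pos = decode-positive (toList p) 1≤n lenP ok

    length-decode-toList : length (decode k n (toList p)) ≡ n
    length-decode-toList = length-decode (toList p) 1≤n lenP ok

    decode-toList-IsSpot : All (IsSpot n) (decode k n (toList p))
    decode-toList-IsSpot = All.zip (pos , Desc⇒All≤ desc)

    decode-toList-Tight : Tight (decode k n (toList p))
    decode-toList-Tight =
      desc , encode-target⁻ k desc pos
               (subst (λ Q → T (isTargetPath k Q)) (sym (encode-decode (toList p) 1≤n lenP ok)) ok)

  toTarget : Σ _ IsSource → Σ _ IsTarget
  toTarget (a , ok) = vecOfList (encode k n (spots a)) len ,
    subst (λ P → T (isTargetPath k P)) (sym (toList-vecOfList _ len)) (encode-spots-target a ok)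
    where
    len = length-encode-spots a ok

  fromTarget : Σ _ IsTarget → Σ _ IsSource
  fromTarget (p , ok) = vec , Tight⇒IsSource vec (subst Tight (sym spots-vec) (decode-toList-Tight p ok))
    where
    vec = vecOfSpots _ (length-decode-toList p ok) (decode-toList-IsSpot p ok)
    spots-vec = spots-vecOfSpots _ (length-decode-toList p ok) (decode-toList-IsSpot p ok)

  fromTarget∘toTarget : ∀ x → fromTarget (toTarget x) ≡ x
  fromTarget∘toTarget (a , ok) = Σ-≡,≡→≡ (spots-injective _ a spots≡ , T-irrelevant _ _)
    where
    open ≡-Reasoning
    p = proj₁ (toTarget (a , ok))
    okₚ = proj₂ (toTarget (a , ok))
    spots≡ = begin
      spots (proj₁ (fromTarget (p , okₚ)))
        ≡⟨ spots-vecOfSpots _ (length-decode-toList p okₚ) (decode-toList-IsSpot p okₚ) ⟩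
      decode k n (toList p)
        ≡⟨ cong (decode k n) (toList-vecOfList _ (length-encode-spots a ok)) ⟩
      decode k n (encode k n (spots a))
        ≡⟨ decode-encode k (proj₁ (IsSource⇒Tight a ok)) ⟩
      spots a ∎

  toTarget∘fromTarget : ∀ y → toTarget (fromTarget y) ≡ y
  toTarget∘fromTarget (p , ok) = Σ-≡,≡→≡ (toList-injective′ _ p toList≡ , T-irrelevant _ _)
    where
    open ≡-Reasoning
    vec = proj₁ (fromTarget (p , ok))
    okᵥ = proj₂ (fromTarget (p , ok))
    toList≡ = begin
      toList (proj₁ (toTarget (vec , okᵥ)))
        ≡⟨ toList-vecOfList _ (length-encode-spots vec okᵥ) ⟩
      encode k n (spots vec)
        ≡⟨ cong (encode k n) (spots-vecOfSpots _ (length-decode-toList p ok) (decode-toList-IsSpot p ok)) ⟩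
      encode k n (decode k n (toList p))
        ≡⟨ encode-decode (toList p) 1≤n (length-toList p) ok ⟩
      toList p ∎

  bijection : Σ _ IsSource ⤖ Σ _ IsTarget
  bijection = ↔⇒⤖ (mk↔ₛ′ toTarget fromTarget toTarget∘fromTarget fromTarget∘toTarget)

proposition3p14 : (k n : ℕ) → 1 ≤ k → 1 ≤ n →
    (Σ (Vec (Fin n) n) (λ a →
    T (isDescending a ∧ isNaplesPF k a ∧ not (isNaplesPF (k ∸ 1) a))))
    ⤖
    (Σ (Vec Bool (2 * (n + k))) (λ p → T (isTargetPath k (toList p))))
proposition3p14 k n 1≤k 1≤n = Bijection.bijection k n 1≤k 1≤n
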